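{- Let $F$ be an admissible sequence and $1\le k\le n$, with $m=n-k+1$. Let $G$ be the simple graph whose vertices are all sub-boxes of $V_{m,n}$ of the form $\sigma V_m$ (over all permutations $\sigma$), with two vertices adjacent iff the corresponding sub-boxes are disjoint. Let $d=\binom{n}{m}_F$. Then $V_{m,n}$ has a tiling if and only if $G$ has a clique of size $d$. Moreover, the tilings of $V_{m,n}$ are exactly the sets of $d$ sub-boxes forming cliques of size $d$ in $G$.
   Context: Notation: $n_F!=n_F\cdots1_F$, $0_F!=1$, $\binom{n}{m}_F=\frac{n_F!}{m_F!(n-m)_F!}$. $F$ is admissible if these values are in $\mathbb{N}\cup\{0\}$ for all $n\ge m\ge0$. Write $[s_F]=\{1,\dots,s_F\}$, and let $V_{m,n}=[k_F]\times\cdots\times[n_F]$. A sub-box of the form $\sigma V_m$ is $A_1\times\cdots\times A_m$ with $A_s\subseteq[(k+s-1)_F]$ and $|A_s|=(\sigma(s))_F$, where $\sigma$ is a permutation of $\{1,\dots,m\}$. A tiling is a partition of $V_{m,n}$ into pairwise disjoint such sub-boxes. In cobweb language, points correspond to maximal paths of the layer $\langle\Phi_k\to\Phi_n\rangle$, sub-boxes to blocks $\sigma P_m$, and disjointness to max-disjointness. -}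

module Defs where

open import Data.Nat using (ℕ; zero; suc; _+_; _*_; _∸_; _≤_)
open import Data.Nat.Divisibility using (_∣_)
open import Data.Fin using (Fin; toℕ)
open import Data.Fin.Subset using (Subset; ∣_∣) renaming (_∈_ to _∈ₛ_)
open import Data.Fin.Permutation using (Permutation′; _⟨$⟩ʳ_)
open import Data.Product using (Σ; _×_)
open import Data.Empty using (⊥)
open import Relation.Nullary using (¬_)
open import Relation.Binary.PropositionalEquality using (_≡_; _≢_)

-- A sequence F, with F n read as n_F (F 0 is never used).
-- F-factorial: 0_F! = 1, (n+1)_F! = (n+1)_F * n_F!.
fact : (ℕ → ℕ) → ℕ → ℕ
fact F zero    = 1
fact F (suc n) = F (suc n) * fact F n

-- Admissible: every F-binomial n_F!/(m_F!(n-m)_F!) (m ≤ n) is a well-defined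
-- natural number: denominator nonzero and dividing the numerator.
Admissible : (ℕ → ℕ) → Set
Admissible F = ∀ n m → m ≤ n →
  (fact F m * fact F (n ∸ m) ≢ 0) × (fact F m * fact F (n ∸ m) ∣ fact F n)

-- Coordinate s (0-indexed, s = 0 .. m-1) of V_{m,n} ranges over [(k+s)_F],
-- i.e. the paper's coordinate s+1 ranging over [(k+(s+1)-1)_F].
Coord : (ℕ → ℕ) → ℕ → {m : ℕ} → Fin m → ℕ
Coord F k s = F (k + toℕ s)

-- Points of V_{m,n} = [k_F] × ... × [n_F]  (with m = n-k+1 factors).
Point : (ℕ → ℕ) → ℕ → ℕ → Set
Point F k m = (s : Fin m) → Fin (Coord F k s)

BoxSets : (ℕ → ℕ) → ℕ → ℕ → Set
BoxSets F k m = (s : Fin m) → Subset (Coord F k s)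

-- The box is of the form σ V_m for some permutation σ of {1..m}:
-- |A_s| = (σ(s))_F  (σ(s) ∈ {1..m} is suc of the 0-indexed image).
IsSubBox : (F : ℕ → ℕ) (k m : ℕ) → BoxSets F k m → Set
IsSubBox F k m A =
  Σ (Permutation′ m) λ σ → ∀ s → ∣ A s ∣ ≡ F (suc (toℕ (σ ⟨$⟩ʳ s)))

record SubBox (F : ℕ → ℕ) (k m : ℕ) : Set where
  constructor subBox
  field
    sets  : BoxSets F k m
    shape : IsSubBox F k m sets
open SubBox public

_∈B_ : ∀ {F k m} → Point F k m → SubBox F k m → Set
x ∈B B = ∀ s → x s ∈ₛ sets B s

SameBox : ∀ {F k m} → SubBox F k m → SubBox F k m → Set
SameBox B C = ∀ s → sets B s ≡ sets C s

Disjoint : ∀ {F k m} → SubBox F k m → SubBox F k m → Set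
Disjoint {F} {k} {m} B C = (x : Point F k m) → ¬ (x ∈B B × x ∈B C)

Distinct : ∀ {F k m t} → (Fin t → SubBox F k m) → Set
Distinct {t = t} T = (i j : Fin t) → SameBox (T i) (T j) → i ≡ j

IsClique : ∀ {F k m t} → (Fin t → SubBox F k m) → Set
IsClique {t = t} T =
  Distinct T × ((i j : Fin t) → i ≢ j → Disjoint (T i) (T j))

IsTiling : ∀ {F k m t} → (Fin t → SubBox F k m) → Set
IsTiling {F} {k} {m} {t} T =
  Distinct T × ((i j : Fin t) → i ≢ j → Disjoint (T i) (T j))
  × ((x : Point F k m) → Σ (Fin t) λ i → x ∈B T i)

HasTiling : (F : ℕ → ℕ) (k m : ℕ) → Set
HasTiling F k m = Σ ℕ λ t → Σ (Fin t → SubBox F k m) λ T → IsTiling T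

HasCliqueOfSize : (F : ℕ → ℕ) (k m : ℕ) → ℕ → Set
HasCliqueOfSize F k m d = Σ (Fin d → SubBox F k m) λ T → IsClique T

-- A sub-box σ V_m has ∏ₛ (σ s)_F = m_F! points, and V_{m,n} has ∏ₛ (k+s)_F = n_F! / (k-1)_F!
-- = d · m_F! points.  If T₁ … T_t are pairwise disjoint, every point lies in at most one of
-- them and these multiplicities sum to t · m_F! over V_{m,n}.  So the Tᵢ cover V_{m,n} iff
-- every multiplicity is 1, iff t · m_F! = d · m_F!, iff t = d.
module Submission where

open import Defs
open import Data.Nat using (ℕ; zero; suc; _+_; _*_; _∸_; _≤_; _≟_; z≤n; s≤s; ≢-nonZero)
open import Data.Nat.Properties
open import Data.Fin using (Fin; zero; suc; toℕ)
import Data.Fin.Properties as Finₚ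
open import Data.Fin.Subset using (Subset; ∣_∣) renaming (_∈_ to _∈ₛ_)
open import Data.Fin.Permutation using (_⟨$⟩ʳ_)
open import Data.Vec using ([]; _∷_; lookup)
open import Data.Vec.Properties using ([]=⇒lookup; lookup⇒[]=)
open import Data.Bool using (Bool; true; false)
open import Data.Product using (Σ; ∃; _×_; _,_; proj₁)
open import Data.Empty using (⊥-elim)
open import Function using (_∘_; case_of_; _⇔_; mk⇔; Equivalence)
import Function.Properties.Equivalence as ⇔
open import Relation.Binary.Core using (_Preserves_⟶_)
open import Relation.Binary.PropositionalEquality
open import Relation.Nullary using (yes; no)
open import Algebra.Properties.Semiring.Sum +-*-semiring
  using (sum; sum-syntax; sum-cong-≗; sum-replicate-zero; ∑-comm; *-distribˡ-sum; *-distribʳ-sum)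
open import Algebra.Properties.CommutativeMonoid.Sum *-1-commutativeMonoid
  using () renaming (sum to ∏; sum-cong-≗ to ∏-cong; sum-replicate-zero to ∏-replicate-1;
                     sum-permute to ∏-permute)

∑-mono-≤ : ∀ {n} {f g : Fin n → ℕ} → (∀ i → f i ≤ g i) → ∑[ i < n ] f i ≤ ∑[ i < n ] g i
∑-mono-≤ {zero}  f≤g = z≤n
∑-mono-≤ {suc n} f≤g = +-mono-≤ (f≤g zero) (∑-mono-≤ (f≤g ∘ suc))

∑-const : ∀ n K → ∑[ i < n ] K ≡ n * K
∑-const zero    K = refl
∑-const (suc n) K = cong (K +_) (∑-const n K)

≤-∑ : ∀ {n} (f : Fin n → ℕ) i → f i ≤ sum f
≤-∑ f zero    = m≤m+n _ _
≤-∑ f (suc i) = ≤-trans (≤-∑ (f ∘ suc) i) (m≤n+m _ _)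

≤-∑-≡⇒≡ : ∀ {n} {f g : Fin n → ℕ} → (∀ i → f i ≤ g i) → sum f ≡ sum g → ∀ i → f i ≡ g i
≤-∑-≡⇒≡ {suc n} {f} {g} f≤g eq = λ where
    zero    → f₀≡g₀
    (suc i) → ≤-∑-≡⇒≡ (f≤g ∘ suc) (+-cancelˡ-≡ (g zero) _ _ (subst (λ v → v + _ ≡ _) f₀≡g₀ eq)) i
  where
  g₀≤f₀ : g zero ≤ f zero
  g₀≤f₀ = +-cancelʳ-≤ (sum (f ∘ suc)) _ _
    (≤-trans (+-monoʳ-≤ (g zero) (∑-mono-≤ (f≤g ∘ suc))) (≤-reflexive (sym eq)))
  f₀≡g₀ : f zero ≡ g zero
  f₀≡g₀ = ≤-antisym (f≤g zero) g₀≤f₀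

∑-≡0 : ∀ {n} {f : Fin n → ℕ} → (∀ i → f i ≡ 0) → sum f ≡ 0
∑-≡0 {n} f≡0 = trans (sum-cong-≗ f≡0) (sum-replicate-zero n)

∑≤1 : ∀ {n} (f : Fin n → ℕ) → (∀ i → f i ≤ 1) → (∀ i j → f i ≢ 0 → f j ≢ 0 → i ≡ j) → sum f ≤ 1
∑≤1 {zero}  f f≤1 unique = z≤n
∑≤1 {suc n} f f≤1 unique with f zero ≟ 0
... | yes f₀≡0 = subst (λ v → v + sum (f ∘ suc) ≤ 1) (sym f₀≡0)
                   (∑≤1 (f ∘ suc) (f≤1 ∘ suc) (λ i j fi≢0 fj≢0 → Finₚ.suc-injective (unique _ _ fi≢0 fj≢0)))
... | no f₀≢0 =
  subst (λ v → f zero + v ≤ 1) (sym (∑-≡0 rest≡0)) (≤-trans (≤-reflexive (+-identityʳ _)) (f≤1 zero))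
  where
  rest≡0 : ∀ i → f (suc i) ≡ 0
  rest≡0 i with f (suc i) ≟ 0
  ... | yes fi≡0 = fi≡0
  ... | no  fi≢0 with () ← unique zero (suc i) f₀≢0 fi≢0

∑≢0⇒∃≢0 : ∀ {n} (f : Fin n → ℕ) → sum f ≢ 0 → ∃ λ i → f i ≢ 0
∑≢0⇒∃≢0 {zero}  f ∑≢0 = ⊥-elim (∑≢0 refl)
∑≢0⇒∃≢0 {suc n} f ∑≢0 with f zero ≟ 0
... | no  f₀≢0 = zero , f₀≢0
... | yes f₀≡0 with i , fi≢0 ← ∑≢0⇒∃≢0 (f ∘ suc) (λ ∑≡0 → ∑≢0 (cong₂ _+_ f₀≡0 ∑≡0)) = suc i , fi≢0

∏≢0⇒≢0 : ∀ {n} (f : Fin n → ℕ) → ∏ f ≢ 0 → ∀ i → f i ≢ 0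
∏≢0⇒≢0 f ∏≢0 zero    f₀≡0 = ∏≢0 (cong (_* ∏ (f ∘ suc)) f₀≡0)
∏≢0⇒≢0 f ∏≢0 (suc i) = ∏≢0⇒≢0 (f ∘ suc) (λ ∏≡0 → ∏≢0 (trans (cong (f zero *_) ∏≡0) (*-zeroʳ (f zero)))) i

Grid : ∀ {m} → (Fin m → ℕ) → Set
Grid {m} c = (s : Fin m) → Fin (c s)

_∷ᴳ_ : ∀ {m} {c : Fin (suc m) → ℕ} → Fin (c zero) → Grid (c ∘ suc) → Grid c
(i ∷ᴳ x) zero    = i
(i ∷ᴳ x) (suc s) = x s

_≈ᴳ_ : ∀ {m} {c : Fin m → ℕ} → Grid c → Grid c → Set
x ≈ᴳ y = ∀ s → x s ≡ y s

∷ᴳ-cong : ∀ {m} {c : Fin (suc m) → ℕ} (i : Fin (c zero)) {x y : Grid (c ∘ suc)} →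
  x ≈ᴳ y → (_∷ᴳ_ {c = c} i x) ≈ᴳ (i ∷ᴳ y)
∷ᴳ-cong i x≈y zero    = refl
∷ᴳ-cong i x≈y (suc s) = x≈y s

∑ᴳ : ∀ {m} (c : Fin m → ℕ) → (Grid c → ℕ) → ℕ
∑ᴳ {zero}  c f = f (λ ())
∑ᴳ {suc m} c f = ∑[ i < c zero ] ∑ᴳ (c ∘ suc) (λ x → f (i ∷ᴳ x))

∑ᴳ-cong : ∀ {m} {c : Fin m → ℕ} {f g : Grid c → ℕ} → (∀ x → f x ≡ g x) → ∑ᴳ c f ≡ ∑ᴳ c g
∑ᴳ-cong {zero}  f≗g = f≗g _
∑ᴳ-cong {suc m} f≗g = sum-cong-≗ (λ i → ∑ᴳ-cong (λ x → f≗g (i ∷ᴳ x)))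

∑ᴳ-mono-≤ : ∀ {m} {c : Fin m → ℕ} {f g : Grid c → ℕ} → (∀ x → f x ≤ g x) → ∑ᴳ c f ≤ ∑ᴳ c g
∑ᴳ-mono-≤ {zero}  f≤g = f≤g _
∑ᴳ-mono-≤ {suc m} f≤g = ∑-mono-≤ (λ i → ∑ᴳ-mono-≤ (λ x → f≤g (i ∷ᴳ x)))

∑ᴳ-1 : ∀ {m} (c : Fin m → ℕ) → ∑ᴳ c (λ _ → 1) ≡ ∏ c
∑ᴳ-1 {zero}  c = refl
∑ᴳ-1 {suc m} c = trans (sum-cong-≗ {c zero} (λ _ → ∑ᴳ-1 (c ∘ suc))) (∑-const (c zero) _)

∑ᴳ-comm : ∀ {m} {c : Fin m → ℕ} {t} (f : Fin t → Grid c → ℕ) →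
  ∑ᴳ c (λ x → ∑[ i < t ] f i x) ≡ ∑[ i < t ] ∑ᴳ c (f i)
∑ᴳ-comm {zero}          f = refl
∑ᴳ-comm {suc m} {c} {t} f = begin
  ∑[ j < c zero ] ∑ᴳ (c ∘ suc) (λ x → ∑[ i < t ] f i (j ∷ᴳ x))
    ≡⟨ sum-cong-≗ (λ j → ∑ᴳ-comm (λ i x → f i (j ∷ᴳ x))) ⟩
  ∑[ j < c zero ] ∑[ i < t ] ∑ᴳ (c ∘ suc) (λ x → f i (j ∷ᴳ x))
    ≡⟨ ∑-comm (λ j i → ∑ᴳ (c ∘ suc) (λ x → f i (j ∷ᴳ x))) ⟩
  ∑[ i < t ] ∑[ j < c zero ] ∑ᴳ (c ∘ suc) (λ x → f i (j ∷ᴳ x))  ∎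
  where open ≡-Reasoning

*-distribˡ-∑ᴳ : ∀ {m} {c : Fin m → ℕ} K (f : Grid c → ℕ) → K * ∑ᴳ c f ≡ ∑ᴳ c (λ x → K * f x)
*-distribˡ-∑ᴳ {zero}  K f = refl
*-distribˡ-∑ᴳ {suc m} {c} K f =
  trans (*-distribˡ-sum K (λ i → ∑ᴳ (c ∘ suc) (f ∘ (i ∷ᴳ_))))
        (sum-cong-≗ {c zero} (λ i → *-distribˡ-∑ᴳ K (f ∘ (i ∷ᴳ_))))

∑ᴳ-∏ : ∀ {m} {c : Fin m → ℕ} (g : (s : Fin m) → Fin (c s) → ℕ) →
  ∑ᴳ c (λ x → ∏ (λ s → g s (x s))) ≡ ∏ (λ s → sum (g s))
∑ᴳ-∏ {zero}      g = refl
∑ᴳ-∏ {suc m} {c} g = begin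
  ∑[ i < c zero ] ∑ᴳ (c ∘ suc) (λ x → g zero i * ∏ (λ s → g (suc s) (x s)))
    ≡⟨ sum-cong-≗ {c zero} (λ i → sym (*-distribˡ-∑ᴳ {c = c ∘ suc} (g zero i) _)) ⟩
  ∑[ i < c zero ] (g zero i * ∑ᴳ (c ∘ suc) (λ x → ∏ (λ s → g (suc s) (x s))))
    ≡⟨ sym (*-distribʳ-sum _ (g zero)) ⟩
  sum (g zero) * ∑ᴳ (c ∘ suc) (λ x → ∏ (λ s → g (suc s) (x s)))
    ≡⟨ cong (sum (g zero) *_) (∑ᴳ-∏ (g ∘ suc)) ⟩
  sum (g zero) * ∏ (λ s → sum (g (suc s)))  ∎
  where open ≡-Reasoning

-- The congruence hypotheses are needed because, without function extensionality,
-- x and x zero ∷ᴳ (x ∘ suc) are only pointwise equal.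
≤-∑ᴳ-≡⇒≡ : ∀ {m} {c : Fin m → ℕ} {f g : Grid c → ℕ} →
  f Preserves _≈ᴳ_ ⟶ _≡_ → g Preserves _≈ᴳ_ ⟶ _≡_ →
  (∀ x → f x ≤ g x) → ∑ᴳ c f ≡ ∑ᴳ c g → ∀ x → f x ≡ g x
≤-∑ᴳ-≡⇒≡ {zero}  f-cong g-cong f≤g eq x = trans (f-cong (λ ())) (trans eq (g-cong (λ ())))
≤-∑ᴳ-≡⇒≡ {suc m} {c} {f} {g} f-cong g-cong f≤g eq x = begin
  f x                          ≡⟨ f-cong x≈x₀∷x₊ ⟩
  f (x zero ∷ᴳ (x ∘ suc))      ≡⟨ ≤-∑ᴳ-≡⇒≡ (f-cong ∘ ∷ᴳ-cong _) (g-cong ∘ ∷ᴳ-cong _) (λ y → f≤g _)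
                                    (slices-equal (x zero)) (x ∘ suc) ⟩
  g (x zero ∷ᴳ (x ∘ suc))      ≡⟨ g-cong (sym ∘ x≈x₀∷x₊) ⟩
  g x                          ∎
  where
  open ≡-Reasoning
  x≈x₀∷x₊ : x ≈ᴳ (x zero ∷ᴳ (x ∘ suc))
  x≈x₀∷x₊ zero    = refl
  x≈x₀∷x₊ (suc s) = refl
  slices-equal : ∀ i → ∑ᴳ (c ∘ suc) (λ y → f (i ∷ᴳ y)) ≡ ∑ᴳ (c ∘ suc) (λ y → g (i ∷ᴳ y))
  slices-equal = ≤-∑-≡⇒≡ (λ i → ∑ᴳ-mono-≤ (λ y → f≤g (i ∷ᴳ y))) eq

≡1⇔∑ᴳ≡∏ : ∀ {m} {c : Fin m → ℕ} {f : Grid c → ℕ} → f Preserves _≈ᴳ_ ⟶ _≡_ → (∀ x → f x ≤ 1) →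
  (∀ x → f x ≡ 1) ⇔ (∑ᴳ c f ≡ ∏ c)
≡1⇔∑ᴳ≡∏ {c = c} f-cong f≤1 = mk⇔
  (λ f≡1 → trans (∑ᴳ-cong f≡1) (∑ᴳ-1 c))
  (λ ∑≡∏ → ≤-∑ᴳ-≡⇒≡ f-cong (λ _ → refl) f≤1 (trans ∑≡∏ (sym (∑ᴳ-1 c))))

bit : Bool → ℕ
bit true  = 1
bit false = 0

∑-bit≡∣∣ : ∀ {n} (A : Subset n) → ∑[ j < n ] bit (lookup A j) ≡ ∣ A ∣
∑-bit≡∣∣ []          = refl
∑-bit≡∣∣ (true  ∷ A) = cong suc (∑-bit≡∣∣ A)
∑-bit≡∣∣ (false ∷ A) = ∑-bit≡∣∣ A

module _ {m} {c : Fin m → ℕ} (A : (s : Fin m) → Subset (c s)) where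

  indicator : Grid c → ℕ
  indicator x = ∏ (λ s → bit (lookup (A s) (x s)))

  indicator-cong : indicator Preserves _≈ᴳ_ ⟶ _≡_
  indicator-cong x≈y = ∏-cong (λ s → cong (bit ∘ lookup (A s)) (x≈y s))

  ∈⇒indicator≡1 : ∀ {x} → (∀ s → x s ∈ₛ A s) → indicator x ≡ 1
  ∈⇒indicator≡1 x∈A = trans (∏-cong (λ s → cong bit ([]=⇒lookup (x∈A s)))) (∏-replicate-1 m)

  indicator≢0⇒∈ : ∀ {x} → indicator x ≢ 0 → ∀ s → x s ∈ₛ A s
  indicator≢0⇒∈ {x} ind≢0 s = lookup⇒[]= (x s) (A s) (bit≢0⇒true (∏≢0⇒≢0 _ ind≢0 s))
    where
    bit≢0⇒true : ∀ {b} → bit b ≢ 0 → b ≡ true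
    bit≢0⇒true {true}  _     = refl
    bit≢0⇒true {false} 0≢0 = ⊥-elim (0≢0 refl)

  indicator≤1 : ∀ x → indicator x ≤ 1
  indicator≤1 x with indicator x ≟ 0
  ... | yes ind≡0 = ≤-trans (≤-reflexive ind≡0) z≤n
  ... | no  ind≢0 = ≤-reflexive (∈⇒indicator≡1 (indicator≢0⇒∈ ind≢0))

  ∑ᴳ-indicator : ∑ᴳ c indicator ≡ ∏ (λ s → ∣ A s ∣)
  ∑ᴳ-indicator = trans (∑ᴳ-∏ (λ s → bit ∘ lookup (A s))) (∏-cong (λ s → ∑-bit≡∣∣ (A s)))

volume : (F : ℕ → ℕ) (k m : ℕ) → ℕ
volume F k m = ∏ (Coord F k {m})

fact-+ : ∀ (F : ℕ → ℕ) a m → ∏ (λ (s : Fin m) → F (suc a + toℕ s)) * fact F a ≡ fact F (a + m)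
fact-+ F a zero    = trans (*-identityˡ _) (cong (fact F) (sym (+-identityʳ a)))
fact-+ F a (suc m) = begin
  F (suc a + 0) * P * fact F a
    ≡⟨ cong (λ v → F v * P * fact F a) (cong suc (+-identityʳ a)) ⟩
  F (suc a) * P * fact F a
    ≡⟨ cong (_* fact F a) (*-comm (F (suc a)) P) ⟩
  P * F (suc a) * fact F a
    ≡⟨ *-assoc P (F (suc a)) (fact F a) ⟩
  P * fact F (suc a)
    ≡⟨ cong (_* fact F (suc a)) (∏-cong {m} (λ s → cong F (cong suc (+-suc a (toℕ s))))) ⟩
  ∏ (λ (s : Fin m) → F (suc (suc a) + toℕ s)) * fact F (suc a)
    ≡⟨ fact-+ F (suc a) m ⟩
  fact F (suc a + m)
    ≡⟨ cong (fact F) (sym (+-suc a m)) ⟩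
  fact F (a + suc m)  ∎
  where
  open ≡-Reasoning
  P = ∏ (λ (s : Fin m) → F (suc a + suc (toℕ s)))

∑ᴳ-subBox : ∀ {F k m} (B : SubBox F k m) → ∑ᴳ (Coord F k) (indicator (sets B)) ≡ fact F m
∑ᴳ-subBox {F} {k} {m} (subBox A (σ , ∣A∣≡)) = begin
  ∑ᴳ (Coord F k) (indicator A)                ≡⟨ ∑ᴳ-indicator A ⟩
  ∏ (λ s → ∣ A s ∣)                           ≡⟨ ∏-cong ∣A∣≡ ⟩
  ∏ (λ s → F (suc (toℕ (σ ⟨$⟩ʳ s))))          ≡⟨ ∏-permute (λ s → F (suc (toℕ s))) σ ⟨
  ∏ (λ (s : Fin m) → F (suc (toℕ s)))         ≡⟨ *-identityʳ _ ⟨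
  ∏ (λ (s : Fin m) → F (suc (toℕ s))) * 1     ≡⟨ fact-+ F 0 m ⟩
  fact F m                                    ∎
  where open ≡-Reasoning

fact≢0 : ∀ {F} → Admissible F → ∀ n → fact F n ≢ 0
fact≢0 admissible n n!≡0 = proj₁ (admissible n 0 z≤n) (trans (*-identityˡ _) n!≡0)

volume≡d*m! : ∀ {F a m d} → fact F a ≢ 0 → d * (fact F m * fact F a) ≡ fact F (a + m) →
  volume F (suc a) m ≡ d * fact F m
volume≡d*m! {F} {a} {m} {d} a!≢0 d*m!*a!≡[a+m]! = *-cancelʳ-≡ _ _ (fact F a) {{≢-nonZero a!≢0}} (begin
  volume F (suc a) m * fact F a  ≡⟨ fact-+ F a m ⟩
  fact F (a + m)                 ≡⟨ d*m!*a!≡[a+m]! ⟨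
  d * (fact F m * fact F a)      ≡⟨ *-assoc d _ _ ⟨
  d * fact F m * fact F a        ∎)
  where open ≡-Reasoning

module _ {F k m t} (T : Fin t → SubBox F k m) where

  PairwiseDisjoint : Set
  PairwiseDisjoint = (i j : Fin t) → i ≢ j → Disjoint (T i) (T j)

  Covers : Set
  Covers = (x : Point F k m) → Σ (Fin t) λ i → x ∈B T i

  multiplicity : Point F k m → ℕ
  multiplicity x = ∑[ i < t ] indicator (sets (T i)) x

  ∑ᴳ-multiplicity : ∑ᴳ (Coord F k) multiplicity ≡ t * fact F m
  ∑ᴳ-multiplicity = begin
    ∑ᴳ (Coord F k) multiplicity                        ≡⟨ ∑ᴳ-comm (λ i → indicator (sets (T i))) ⟩
    ∑[ i < t ] ∑ᴳ (Coord F k) (indicator (sets (T i))) ≡⟨ sum-cong-≗ (∑ᴳ-subBox ∘ T) ⟩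
    ∑[ i < t ] fact F m                                ≡⟨ ∑-const t (fact F m) ⟩
    t * fact F m                                       ∎
    where open ≡-Reasoning

  multiplicity≤1 : PairwiseDisjoint → ∀ x → multiplicity x ≤ 1
  multiplicity≤1 disjoint x = ∑≤1 _ (λ i → indicator≤1 (sets (T i)) x) at-most-one
    where
    at-most-one : ∀ i j → indicator (sets (T i)) x ≢ 0 → indicator (sets (T j)) x ≢ 0 → i ≡ j
    at-most-one i j x∈Tᵢ x∈Tⱼ with i Finₚ.≟ j
    ... | yes i≡j = i≡j
    ... | no  i≢j = ⊥-elim (disjoint i j i≢j x (indicator≢0⇒∈ _ x∈Tᵢ , indicator≢0⇒∈ _ x∈Tⱼ))

  covers⇔multiplicity≡1 : PairwiseDisjoint → Covers ⇔ (∀ x → multiplicity x ≡ 1)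
  covers⇔multiplicity≡1 disjoint = mk⇔ covered⇒≡1 ≡1⇒covered
    where
    covered⇒≡1 : Covers → ∀ x → multiplicity x ≡ 1
    covered⇒≡1 covers x with i , x∈Tᵢ ← covers x =
      ≤-antisym (multiplicity≤1 disjoint x)
        (≤-trans (≤-reflexive (sym (∈⇒indicator≡1 _ x∈Tᵢ))) (≤-∑ (λ j → indicator (sets (T j)) x) i))
    ≡1⇒covered : (∀ x → multiplicity x ≡ 1) → Covers
    ≡1⇒covered multiplicity≡1 x
      with i , x∈Tᵢ ← ∑≢0⇒∃≢0 _ (λ ∑≡0 → 1+n≢0 (trans (sym (multiplicity≡1 x)) ∑≡0)) =
      i , indicator≢0⇒∈ _ x∈Tᵢ

  covers⇔t*m!≡volume : PairwiseDisjoint → Covers ⇔ (t * fact F m ≡ volume F k m)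
  covers⇔t*m!≡volume disjoint =
    ⇔.trans (covers⇔multiplicity≡1 disjoint)
      (subst (λ v → (∀ x → multiplicity x ≡ 1) ⇔ (v ≡ volume F k m)) ∑ᴳ-multiplicity
        (≡1⇔∑ᴳ≡∏ (λ x≈y → sum-cong-≗ (λ i → indicator-cong (sets (T i)) x≈y)) (multiplicity≤1 disjoint)))

covers⇔t≡d : ∀ {F k m d t} → fact F m ≢ 0 → volume F k m ≡ d * fact F m →
  (T : Fin t → SubBox F k m) → PairwiseDisjoint T → Covers T ⇔ (t ≡ d)
covers⇔t≡d {F} {k} {m} {d} {t} m!≢0 volume≡d*m! T disjoint =
  ⇔.trans (covers⇔t*m!≡volume T disjoint)
    (mk⇔ (λ t*m!≡volume → *-cancelʳ-≡ t d (fact F m) {{≢-nonZero m!≢0}} (trans t*m!≡volume volume≡d*m!))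
         (λ t≡d → trans (cong (_* fact F m) t≡d) (sym volume≡d*m!)))

tiling⇔clique : ∀ {F k m d t} → fact F m ≢ 0 → volume F k m ≡ d * fact F m →
  (T : Fin t → SubBox F k m) → IsTiling T ⇔ (t ≡ d × IsClique T)
tiling⇔clique m!≢0 volume≡d*m! T = mk⇔
  (λ (distinct , disjoint , covers) →
     Equivalence.to (covers⇔t≡d m!≢0 volume≡d*m! T disjoint) covers , distinct , disjoint)
  (λ (t≡d , distinct , disjoint) →
     distinct , disjoint , Equivalence.from (covers⇔t≡d m!≢0 volume≡d*m! T disjoint) t≡d)

hasTiling⇔hasClique : ∀ {F k m d} →
  (∀ t (T : Fin t → SubBox F k m) → IsTiling T ⇔ (t ≡ d × IsClique T)) →
  HasTiling F k m ⇔ HasCliqueOfSize F k m d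
hasTiling⇔hasClique tiling⇔ = mk⇔
  (λ (t , T , tiling) → case Equivalence.to (tiling⇔ t T) tiling of λ where (refl , clique) → T , clique)
  (λ (T , clique) → _ , T , Equivalence.from (tiling⇔ _ T) (refl , clique))

mainTheorem9 : (F : ℕ → ℕ) → Admissible F → (k n : ℕ) → 1 ≤ k → k ≤ n →
    (d : ℕ) → d * (fact F (suc (n ∸ k)) * fact F (n ∸ suc (n ∸ k))) ≡ fact F n →
    (HasTiling F k (suc (n ∸ k)) ⇔ HasCliqueOfSize F k (suc (n ∸ k)) d)
    × ((t : ℕ) (T : Fin t → SubBox F k (suc (n ∸ k))) →
         IsTiling T ⇔ (t ≡ d × IsClique T))
mainTheorem9 F admissible (suc a) (suc n) (s≤s z≤n) (s≤s a≤n) d d*m!*[n-m]!≡n! =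
  hasTiling⇔hasClique tilings , tilings
  where
  m = suc (n ∸ a)
  d*m!*a!≡[a+m]! : d * (fact F m * fact F a) ≡ fact F (a + m)
  d*m!*a!≡[a+m]! = subst₂ (λ b c → d * (fact F m * fact F b) ≡ fact F c)
    (m∸[m∸n]≡n a≤n) (sym (trans (+-suc a (n ∸ a)) (cong suc (m+[n∸m]≡n a≤n)))) d*m!*[n-m]!≡n!
  tilings : ∀ t (T : Fin t → SubBox F (suc a) m) → IsTiling T ⇔ (t ≡ d × IsClique T)
  tilings t = tiling⇔clique (fact≢0 admissible m)
    (volume≡d*m! {F} {a} {m} {d} (fact≢0 admissible a) d*m!*a!≡[a+m]!)
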